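{- Let $n\ge 3$ be an integer. The complete graph $K_n$ is an $\langle i,j\rangle$ competition graph for all integers $i\ge n-1$ and $j\ge 2$. Further, $K_n$ is not a $\langle k,1\rangle$ competition graph for any integer $k\ge 1$.
   Context: All digraphs are finite, without loops and without parallel arcs; all graphs are finite and simple. The competition graph of a digraph $D$ has vertex set $V(D)$ and an edge $uv$ ($u\ne v$) iff $u$ and $v$ have a common out-neighbor in $D$. For positive integers $i,j$, an $\langle i,j\rangle$ digraph is a loopless digraph in which every vertex has indegree at most $i$ and outdegree at most $j$ (not necessarily acyclic). An $\langle i,j\rangle$ competition graph is the competition graph of some $\langle i,j\rangle$ digraph. -}

module Defs where

open import Data.Nat using (ℕ; zero; suc; _+_; _≤_)
open import Data.Fin using (Fin; zero; suc)
open import Data.Bool using (Bool; true; false; T)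
open import Data.Product using (Σ; ∃; _×_)
open import Relation.Nullary using (¬_)
open import Relation.Binary.PropositionalEquality using (_≡_; _≢_)
open import Function.Bundles using (_⇔_)

-- A digraph on vertex set Fin n, given by its (decidable) arc relation:
-- arc u v ≡ true  iff  there is an arc u → v.  No parallel arcs by construction.
Digraph : ℕ → Set
Digraph n = Fin n → Fin n → Bool

countTrue : ∀ {m} → (Fin m → Bool) → ℕ
countTrue {zero}  f = 0
countTrue {suc m} f with f zero
... | true  = suc (countTrue (λ k → f (suc k)))
... | false = countTrue (λ k → f (suc k))

outdeg : ∀ {n} → Digraph n → Fin n → ℕ
outdeg D u = countTrue (λ v → D u v)

indeg : ∀ {n} → Digraph n → Fin n → ℕ
indeg D v = countTrue (λ u → D u v)

Loopless : ∀ {n} → Digraph n → Set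
Loopless D = ∀ u → D u u ≡ false

IsIJDigraph : ∀ {n} → ℕ → ℕ → Digraph n → Set
IsIJDigraph i j D = Loopless D × (∀ v → indeg D v ≤ i) × (∀ v → outdeg D v ≤ j)

-- A simple graph on Fin n, given by an edge relation (only used for u ≢ v).
Graph : ℕ → Set₁
Graph n = Fin n → Fin n → Set

IsCompetitionGraphOf : ∀ {n} → Graph n → Digraph n → Set
IsCompetitionGraphOf G D =
  ∀ u v → u ≢ v → G u v ⇔ (∃ λ w → T (D u w) × T (D v w))

IsIJCompetitionGraph : ∀ {n} → ℕ → ℕ → Graph n → Set
IsIJCompetitionGraph {n} i j G =
  Σ (Digraph n) λ D → IsIJDigraph i j D × IsCompetitionGraphOf G D

K : (n : ℕ) → Graph n
K n u v = u ≢ v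

-- Take 0 and 1 as out-neighbours of every other vertex, and 2 as the second out-neighbour of 0
-- and of 1.  Out-degrees are 2, in-degrees are at most n − 1 as in any loopless digraph, and any
-- two distinct vertices share one of 0, 1, 2.
-- Conversely, with out-degree at most 1 an arc x → w forbids x and w from competing: their
-- common out-neighbour would be w itself, a loop.  The common out-neighbour w of 0 and 1
-- differs from one of them, say x, and x → w while x and w compete in Kₙ.
module Submission where

open import Defs
open import Data.Nat using (ℕ; zero; suc; _+_; _≤_; _<_; _∸_; z≤n; s≤s; s≤s⁻¹)
open import Data.Nat.Properties using (≤-trans; ≤-reflexive; n≤1+n; <⇒≱)
open import Data.Fin using (Fin; zero; suc; _≟_)
open import Data.Bool using (Bool; true; false; T)
open import Data.Unit using (tt)
open import Data.Empty using (⊥-elim)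
open import Data.Product using (∃; _×_; _,_)
open import Relation.Nullary using (¬_; yes; no)
open import Relation.Binary.PropositionalEquality using (_≡_; _≢_; refl; cong; subst; sym)
open import Function.Bundles using (mk⇔; Equivalence)

countTrue≤ : ∀ {m} (f : Fin m → Bool) → countTrue f ≤ m
countTrue≤ {zero}  f = z≤n
countTrue≤ {suc m} f with f zero
... | true  = s≤s (countTrue≤ (λ k → f (suc k)))
... | false = ≤-trans (countTrue≤ (λ k → f (suc k))) (n≤1+n m)

countTrue≤pred : ∀ {m} (f : Fin (suc m) → Bool) a → f a ≡ false → countTrue f ≤ m
countTrue≤pred f zero fa≡false rewrite fa≡false = countTrue≤ (λ k → f (suc k))
countTrue≤pred {suc m} f (suc a) fa≡false with f zero
... | true  = s≤s (countTrue≤pred (λ k → f (suc k)) a fa≡false)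
... | false = countTrue≤ (λ k → f (suc k))

countTrue-false : ∀ m → countTrue {m} (λ _ → false) ≡ 0
countTrue-false zero    = refl
countTrue-false (suc m) = countTrue-false m

countTrue-pos : ∀ {m} (f : Fin m → Bool) a → T (f a) → 0 < countTrue f
countTrue-pos {suc m} f a fa with f zero in f0
... | true = s≤s z≤n
countTrue-pos f zero    fa | false = ⊥-elim (subst T f0 fa)
countTrue-pos f (suc a) fa | false = countTrue-pos (λ k → f (suc k)) a fa

countTrue≤1⇒unique : ∀ {m} (f : Fin m → Bool) a b → countTrue f ≤ 1 → T (f a) → T (f b) → a ≡ b
countTrue≤1⇒unique {suc m} f a b c fa fb with f zero in f0
countTrue≤1⇒unique f zero    zero    c fa fb | _     = refl
countTrue≤1⇒unique f zero    (suc b) c fa fb | true  =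
  ⊥-elim (<⇒≱ (countTrue-pos (λ k → f (suc k)) b fb) (s≤s⁻¹ c))
countTrue≤1⇒unique f (suc a) b       c fa fb | true  =
  ⊥-elim (<⇒≱ (countTrue-pos (λ k → f (suc k)) a fa) (s≤s⁻¹ c))
countTrue≤1⇒unique f zero    (suc b) c fa fb | false = ⊥-elim (subst T f0 fa)
countTrue≤1⇒unique f (suc a) zero    c fa fb | false = ⊥-elim (subst T f0 fb)
countTrue≤1⇒unique f (suc a) (suc b) c fa fb | false =
  cong suc (countTrue≤1⇒unique (λ k → f (suc k)) a b c fa fb)

Compete : ∀ {n} → Digraph n → Fin n → Fin n → Set
Compete D u v = ∃ λ w → T (D u w) × T (D v w)

indeg≤pred : ∀ {m} {D : Digraph (suc m)} → Loopless D → ∀ v → indeg D v ≤ m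
indeg≤pred {D = D} loopless v = countTrue≤pred (λ u → D u v) v (loopless v)

arc⇒¬Compete : ∀ {n} {D : Digraph n} {x w} →
  Loopless D → outdeg D x ≤ 1 → T (D x w) → ¬ Compete D x w
arc⇒¬Compete {D = D} {w = w} loopless out≤1 x→w (w′ , x→w′ , w→w′)
  with countTrue≤1⇒unique (D _) w w′ out≤1 x→w x→w′
... | refl = subst T (loopless w) w→w′

K-not-⟨k,1⟩-competitionGraph : ∀ m k → ¬ IsIJCompetitionGraph k 1 (K (suc (suc m)))
K-not-⟨k,1⟩-competitionGraph m k (D , (loopless , _ , out≤1) , competition) =
  no-common-out-neighbour (compete (λ ()))
  where
  compete : ∀ {u v} → u ≢ v → Compete D u v
  compete {u} {v} u≢v = Equivalence.to (competition u v u≢v) u≢v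

  no-arc-between-distinct : ∀ {x w} → x ≢ w → ¬ T (D x w)
  no-arc-between-distinct x≢w x→w = arc⇒¬Compete {D = D} loopless (out≤1 _) x→w (compete x≢w)

  no-common-out-neighbour : ¬ Compete D zero (suc zero)
  no-common-out-neighbour (w , 0→w , 1→w) with w ≟ zero
  ... | yes refl = no-arc-between-distinct (λ ()) 1→w
  ... | no  w≢0  = no-arc-between-distinct (λ 0≡w → w≢0 (sym 0≡w)) 0→w

isInNeighbourOf : ∀ {n} → Fin n → Fin n → Bool
isInNeighbourOf zero                zero          = false
isInNeighbourOf zero                (suc _)       = true
isInNeighbourOf (suc zero)          zero          = true
isInNeighbourOf (suc zero)          (suc zero)    = false
isInNeighbourOf (suc zero)          (suc (suc _)) = true
isInNeighbourOf (suc (suc zero))    zero          = true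
isInNeighbourOf (suc (suc zero))    (suc zero)    = true
isInNeighbourOf (suc (suc zero))    (suc (suc _)) = false
isInNeighbourOf (suc (suc (suc _))) _             = false

K-digraph : ∀ {n} → Digraph n
K-digraph u w = isInNeighbourOf w u

K-digraph-loopless : ∀ {n} → Loopless (K-digraph {n})
K-digraph-loopless zero                = refl
K-digraph-loopless (suc zero)          = refl
K-digraph-loopless (suc (suc zero))    = refl
K-digraph-loopless (suc (suc (suc _))) = refl

K-digraph-outdeg : ∀ m (u : Fin (3 + m)) → outdeg K-digraph u ≡ 2
K-digraph-outdeg m zero          = cong (λ c → 2 + c) (countTrue-false m)
K-digraph-outdeg m (suc zero)    = cong (λ c → 2 + c) (countTrue-false m)
K-digraph-outdeg m (suc (suc _)) = cong (λ c → 2 + c) (countTrue-false m)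

K-digraph-compete : ∀ {m} (u v : Fin (3 + m)) → u ≢ v → Compete K-digraph u v
K-digraph-compete zero          zero          u≢v = ⊥-elim (u≢v refl)
K-digraph-compete zero          (suc zero)    _   = suc (suc zero) , tt , tt
K-digraph-compete zero          (suc (suc _)) _   = suc zero , tt , tt
K-digraph-compete (suc zero)    zero          _   = suc (suc zero) , tt , tt
K-digraph-compete (suc zero)    (suc _)       _   = zero , tt , tt
K-digraph-compete (suc (suc _)) zero          _   = suc zero , tt , tt
K-digraph-compete (suc (suc _)) (suc _)       _   = zero , tt , tt

K-competitionGraph : ∀ m → IsCompetitionGraphOf (K (3 + m)) K-digraph
K-competitionGraph m u v u≢v = mk⇔ (λ _ → K-digraph-compete u v u≢v) (λ _ → u≢v)

lemma2p4 : (n : ℕ) → 3 ≤ n →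
    ((i j : ℕ) → n ∸ 1 ≤ i → 2 ≤ j → IsIJCompetitionGraph i j (K n))
    × ((k : ℕ) → 1 ≤ k → ¬ IsIJCompetitionGraph k 1 (K n))
lemma2p4 (suc (suc (suc m))) _ = K-is-⟨i,j⟩ , λ k _ → K-not-⟨k,1⟩-competitionGraph (suc m) k
  where
  K-is-⟨i,j⟩ : ∀ i j → 2 + m ≤ i → 2 ≤ j → IsIJCompetitionGraph i j (K (3 + m))
  K-is-⟨i,j⟩ i j n-1≤i 2≤j =
    K-digraph ,
    ( K-digraph-loopless
    , (λ v → ≤-trans (indeg≤pred {D = K-digraph} K-digraph-loopless v) n-1≤i)
    , (λ u → ≤-trans (≤-reflexive (K-digraph-outdeg m u)) 2≤j) ) ,
    K-competitionGraph m
lemma2p4 0                 ()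
lemma2p4 1                 (s≤s ())
lemma2p4 2                 (s≤s (s≤s ()))
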